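{- Let $G=(V,E,A)$ be a mixed acyclic graph and let $S\subseteq V$ be a set of vertices such that the underlying graph of $G-S$ is a clique. Then every vertex $u\in S$ is incident to at most one undirected edge $\{u,v\}\in E$ with $v\in V\setminus S$.
   Context: A mixed graph $G=(V,E,A)$ has a set $E$ of undirected edges and a set $A$ of directed arcs. The underlying graph is obtained by replacing each arc by an undirected edge with the same endpoints. A (mixed) cycle is a closed sequence $v_1,v_2,\dots,v_p=v_1$ traversing pairwise distinct edges/arcs such that for each consecutive pair either $\{v_i,v_{i+1}\}\in E$ or $(v_i,v_{i+1})\in A$ (undirected edges may be traversed in either direction, arcs only forwards). $G$ is mixed acyclic if it contains no such cycle; in particular the undirected edges form a forest. -}

module Defs where

open import Data.Nat using (ℕ)
open import Data.Fin using (Fin)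
open import Data.Fin.Subset using (Subset; _∈_; _∉_)
open import Data.List using (List; []; _∷_)
open import Data.List.Relation.Unary.All using (All)
open import Data.List.Relation.Unary.AllPairs using (AllPairs)
open import Data.Product using (_×_; _,_; Σ)
open import Data.Sum using (_⊎_)
open import Data.Empty using (⊥)
open import Relation.Nullary using (¬_)
open import Relation.Binary.PropositionalEquality using (_≡_)

-- E x y : the undirected edge {x,y} is present; membership of the unordered
--         pair {x,y} in E is expressed by  EdgeIn  below (E x y ⊎ E y x).
record MixedGraph (n : ℕ) : Set₁ where
  field
    E : Fin n → Fin n → Set
    A : Fin n → Fin n → Set

open MixedGraph public

EdgeIn : ∀ {n} → MixedGraph n → Fin n → Fin n → Set
EdgeIn G x y = E G x y ⊎ E G y x

UAdj : ∀ {n} → MixedGraph n → Fin n → Fin n → Set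
UAdj G x y = EdgeIn G x y ⊎ (A G x y ⊎ A G y x)

data Kind : Set where
  und arc : Kind

record Step (n : ℕ) : Set where
  constructor step
  field
    from : Fin n
    kind : Kind
    to   : Fin n

open Step public

ValidStep : ∀ {n} → MixedGraph n → Step n → Set
ValidStep G (step x und y) = EdgeIn G x y
ValidStep G (step x arc y) = A G x y

SameItem : ∀ {n} → Step n → Step n → Set
SameItem (step x und y) (step x' und y') = (x ≡ x' × y ≡ y') ⊎ (x ≡ y' × y ≡ x')
SameItem (step x arc y) (step x' arc y') = x ≡ x' × y ≡ y'
SameItem (step _ und _) (step _ arc _) = ⊥
SameItem (step _ arc _) (step _ und _) = ⊥

ChainEndsAt : ∀ {n} → Step n → List (Step n) → Fin n → Set
ChainEndsAt s []       w = to s ≡ w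
ChainEndsAt s (t ∷ ts) w = (to s ≡ from t) × ChainEndsAt t ts w

IsCycle : ∀ {n} → MixedGraph n → List (Step n) → Set
IsCycle G []       = ⊥
IsCycle G (s ∷ ss) =
  ChainEndsAt s ss (from s)
  × All (ValidStep G) (s ∷ ss)
  × AllPairs (λ a b → ¬ SameItem a b) (s ∷ ss)

MixedAcyclic : ∀ {n} → MixedGraph n → Set
MixedAcyclic G = ¬ Σ (List _) (IsCycle G)

UnderlyingCliqueOutside : ∀ {n} → MixedGraph n → Subset n → Set
UnderlyingCliqueOutside {n} G S =
  (x y : Fin n) → x ∉ S → y ∉ S → ¬ x ≡ y → UAdj G x y

{-# OPTIONS --safe #-}
module Submission where

-- Two undirected edges {u,v} and {u,w} with v ≠ w close, together with any
-- edge or arc between v and w, a mixed triangle u → v → w → u (an arc w → v is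
-- traversed after swapping the roles of v and w). So in a mixed acyclic graph
-- the two distinct neighbours v, w of u outside S cannot be adjacent, contrary
-- to G - S being a clique.

open import Defs
open import Data.Nat using (ℕ)
open import Data.Fin using (Fin; _≟_)
open import Data.Fin.Subset using (Subset; _∈_; _∉_)
open import Data.List using (List; []; _∷_)
open import Data.List.Relation.Unary.All using ([]; _∷_)
open import Data.List.Relation.Unary.AllPairs using ([]; _∷_)
open import Data.Product using (_,_)
open import Data.Sum using (inj₁; inj₂; swap)
open import Function using (_∘_)
open import Relation.Nullary using (¬_)
open import Relation.Nullary.Decidable using (decidable-stable)
open import Relation.Binary.PropositionalEquality using (_≡_; _≢_; refl; sym)

∈∧∉⇒≢ : ∀ {n} {S : Subset n} {u v : Fin n} → u ∈ S → v ∉ S → u ≢ v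
∈∧∉⇒≢ u∈S v∉S refl = v∉S u∈S

triangle : ∀ {n} → Fin n → Fin n → Kind → Fin n → List (Step n)
triangle u v k w = step u und v ∷ step v k w ∷ step w und u ∷ []

triangle-isCycle : ∀ {n} {G : MixedGraph n} {u v w : Fin n} (k : Kind) →
  u ≢ v → u ≢ w → v ≢ w →
  EdgeIn G u v → ValidStep G (step v k w) → EdgeIn G u w →
  IsCycle G (triangle u v k w)
triangle-isCycle {u = u} {v} {w} k u≢v u≢w v≢w uv vw uw =
  (refl , refl , refl) ,
  (uv ∷ vw ∷ swap uw ∷ []) ,
  ((uv≠vw k ∷ uv≠wu ∷ []) ∷ (vw≠wu k ∷ []) ∷ [] ∷ [])
  where
  uv≠vw : ∀ k → ¬ SameItem (step u und v) (step v k w)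
  uv≠vw und (inj₁ (u≡v , _)) = u≢v u≡v
  uv≠vw und (inj₂ (u≡w , _)) = u≢w u≡w
  uv≠vw arc ()

  uv≠wu : ¬ SameItem (step u und v) (step w und u)
  uv≠wu (inj₁ (u≡w , _)) = u≢w u≡w
  uv≠wu (inj₂ (_ , v≡w)) = v≢w v≡w

  vw≠wu : ∀ k → ¬ SameItem (step v k w) (step w und u)
  vw≠wu und (inj₁ (v≡w , _)) = v≢w v≡w
  vw≠wu und (inj₂ (v≡u , _)) = u≢v (sym v≡u)
  vw≠wu arc ()

MixedAcyclic⇒¬UAdj-common-neighbours : ∀ {n} {G : MixedGraph n} → MixedAcyclic G →
  ∀ {u v w} → u ≢ v → u ≢ w → v ≢ w →
  EdgeIn G u v → EdgeIn G u w → ¬ UAdj G v w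
MixedAcyclic⇒¬UAdj-common-neighbours acyclic u≢v u≢w v≢w uv uw (inj₁ vw) =
  acyclic (_ , triangle-isCycle und u≢v u≢w v≢w uv vw uw)
MixedAcyclic⇒¬UAdj-common-neighbours acyclic u≢v u≢w v≢w uv uw (inj₂ (inj₁ vw)) =
  acyclic (_ , triangle-isCycle arc u≢v u≢w v≢w uv vw uw)
MixedAcyclic⇒¬UAdj-common-neighbours acyclic u≢v u≢w v≢w uv uw (inj₂ (inj₂ wv)) =
  acyclic (_ , triangle-isCycle arc u≢w u≢v (v≢w ∘ sym) uw wv uv)

lemma6 : {n : ℕ} (G : MixedGraph n) (S : Subset n) →
    MixedAcyclic G → UnderlyingCliqueOutside G S →
    (u v w : Fin n) → u ∈ S → v ∉ S → w ∉ S →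
    EdgeIn G u v → EdgeIn G u w → v ≡ w
lemma6 G S acyclic clique u v w u∈S v∉S w∉S uv uw =
  decidable-stable (v ≟ w) λ v≢w →
    MixedAcyclic⇒¬UAdj-common-neighbours acyclic
      (∈∧∉⇒≢ u∈S v∉S) (∈∧∉⇒≢ u∈S w∉S) v≢w uv uw
      (clique v w v∉S w∉S v≢w)
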